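{- Let $n\ge1$ and $S,T\subseteq[n]$ with $S\le T$ in the type $C_n$ Gale order. Then $[S,T]$ is a linked toric interval if and only if $S\subseteq[n-1]$ and $T=S\cup\{n\}$.
   Context: Type $C_n$ Gale order on subsets of $[n]$: for $A=\{a_1<\dots<a_j\}$, $B=\{b_1<\dots<b_k\}$, $A\le B$ iff $j\le k$ and $a_{j-i+1}\le b_{k-i+1}$ for all $i\in[j]$; it is a ranked poset with rank function $\ell(A)=\sum_{a\in A}a$. For $S\le T$, $[S,T]=\{A: S\le A\le T\}$, $\Delta[S,T]$ is the delta matroid on $[n]$ with feasible sets $[S,T]$, and $P(\Delta[S,T])=\operatorname{conv}\{e_R: R\in[S,T]\}\subseteq\mathbb{R}^n$ with $e_R=\sum_{i\in R}e_i$. The interval $[S,T]$ is linked if $\dim P(\Delta[S,T])=n$. It is a toric interval if the associated Richardson variety in the Lagrangian Grassmannian is a toric variety for the maximal torus action; by a result of Tsukerman and Williams this holds exactly when $\ell(T)-\ell(S)=\dim P(\Delta[S,T])$. -}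

module Defs where

open import Data.Nat using (ℕ; zero; suc; _+_; _≤_)
open import Data.Integer using (ℤ; 0ℤ; 1ℤ) renaming (_+_ to _+ℤ_; _*_ to _*ℤ_)
open import Data.Bool using (Bool; true; false; if_then_else_)
open import Data.Fin using (Fin)
open import Data.Fin.Subset using (Subset)
open import Data.Vec using (Vec; []; _∷_; lookup)
open import Data.List using (List; []; _∷_; map; reverse)
open import Data.Nat.ListAction using (sum)
open import Data.Product using (_×_; Σ-syntax)
open import Data.Empty using (⊥)
open import Data.Unit using (⊤)
open import Relation.Binary.PropositionalEquality using (_≡_)
open import Relation.Nullary using (¬_)

-- Subsets of [n] = {1,…,n} are represented as Subset n = Vec Bool n;
-- the position i : Fin n stands for the element (toℕ i + 1).

elemsInc : ∀ {n} → Subset n → List ℕ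
elemsInc [] = []
elemsInc (true  ∷ A) = 1 ∷ map suc (elemsInc A)
elemsInc (false ∷ A) = map suc (elemsInc A)

elemsDesc : ∀ {n} → Subset n → List ℕ
elemsDesc A = reverse (elemsInc A)

-- For decreasing lists (a_j,…,a_1) and (b_k,…,b_1):
-- j ≤ k and a_{j-i+1} ≤ b_{k-i+1} for all i ∈ [j].
data TopLe : List ℕ → List ℕ → Set where
  nil  : ∀ {ys} → TopLe [] ys
  cons : ∀ {x xs y ys} → x ≤ y → TopLe xs ys → TopLe (x ∷ xs) (y ∷ ys)

_≤G_ : ∀ {n} → Subset n → Subset n → Set
A ≤G B = TopLe (elemsDesc A) (elemsDesc B)

ℓ : ∀ {n} → Subset n → ℕ
ℓ A = sum (elemsInc A)

InInterval : ∀ {n} → Subset n → Subset n → Subset n → Set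
InInterval S T A = (S ≤G A) × (A ≤G T)

e : ∀ {n} → Subset n → Fin n → ℤ
e R j = if lookup R j then 1ℤ else 0ℤ

Σℤ : ∀ k → (Fin k → ℤ) → ℤ
Σℤ zero    f = 0ℤ
Σℤ (suc k) f = f Fin.zero +ℤ Σℤ k (λ i → f (Fin.suc i))

-- Points e_{F 0}, …, e_{F k} are affinely independent (over ℚ; equivalently
-- over ℤ by clearing denominators): every affine dependence is trivial.
AffinelyIndependent : ∀ {n k} → (Fin (suc k) → Subset n) → Set
AffinelyIndependent {n} {k} F =
  (λ′ : Fin (suc k) → ℤ) →
  Σℤ (suc k) λ′ ≡ 0ℤ →
  ((j : Fin n) → Σℤ (suc k) (λ i → λ′ i *ℤ e (F i) j) ≡ 0ℤ) →
  (i : Fin (suc k)) → λ′ i ≡ 0ℤ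

-- dim P(Δ[S,T]) = d : the polytope conv{e_R : R ∈ [S,T]} has dimension d,
-- i.e. its vertex set contains d+1 affinely independent points but no d+2.
DimP : ∀ {n} → Subset n → Subset n → ℕ → Set
DimP {n} S T d =
  (Σ[ F ∈ (Fin (suc d) → Subset n) ]
     ((i : Fin (suc d)) → InInterval S T (F i)) × AffinelyIndependent F)
  × ((F : Fin (suc (suc d)) → Subset n) →
     ((i : Fin (suc (suc d))) → InInterval S T (F i)) → ¬ AffinelyIndependent F)

Linked : ∀ {n} → Subset n → Subset n → Set
Linked {n} S T = DimP S T n

-- Toric (Tsukerman–Williams criterion): ℓ(T) − ℓ(S) = dim P(Δ[S,T]).
Toric : ∀ {n} → Subset n → Subset n → Set
Toric S T = Σ[ d ∈ ℕ ] (DimP S T d × ℓ S + d ≡ ℓ T)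

-- Write c_p(A) for the number of elements of A exceeding p. The Gale order compares these counts,
-- A ≤ B iff c_p(A) ≤ c_p(B) for all p, and ℓ(A) = Σ_{p<n} c_p(A). If [S,T] is linked then
-- c_p(S) < c_p(T) for every p < n: otherwise c_p is constant on [S,T], so P(Δ[S,T]) lies in a
-- hyperplane. Hence ℓ(T) − ℓ(S) ≥ n = dim P(Δ[S,T]), and the toric equality forces every gap to
-- be 1, which means exactly n ∉ S and T = S ∪ {n}. Conversely, for such S and T the points S,
-- S ∪ {c} (c ∉ S) and S − c ∪ {n} (c ∈ S) lie in [S,T] and are affinely independent, while
-- ℓ(T) − ℓ(S) = n. Affine dependences are produced by fraction-free Gaussian elimination over ℤ.

module Submission where

open import Defs
open import Data.Nat using (ℕ; zero; suc; pred; _+_; _≤_; _<_; _≥_; _≤?_; z≤n; s≤s; s≤s⁻¹)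
open import Data.Nat.Properties using (≤-refl; ≤-trans; ≤-antisym; <⇒≱; ≰⇒>; n≤1+n; m≤n⇒m≤1+n;
  m≤n⇒m<n∨m≡n; +-comm; +-mono-≤; +-monoʳ-≤; +-cancelˡ-≡; +-cancelʳ-≤; 1+n≢n; suc-injective)
open import Data.Nat.ListAction using (sum)
open import Data.Nat.Tactic.RingSolver using () renaming (solve-∀ to solveℕ)
open import Data.Integer as ℤ using (ℤ; 0ℤ; 1ℤ; -_; _-_) renaming (_+_ to _+ℤ_; _*_ to _*ℤ_)
import Data.Integer.Properties as ℤP
open import Data.Integer.Tactic.RingSolver using () renaming (solve-∀ to solveℤ)
open import Algebra.Properties.Semiring.Sum ℤP.+-*-semiring
  using (sum-cong-≗; sum-replicate-zero; sum-remove; ∑-distrib-+; ∑-comm; *-distribˡ-sum; *-distribʳ-sum)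
  renaming (sum to ∑)
open import Data.Bool using (Bool; true; false; not; if_then_else_)
open import Data.Bool.Properties using (∨-zeroʳ; ∨-identityʳ; ¬-not)
open import Data.List using (List; []; _∷_; map; length; filter; reverse; _∷ʳ_)
open import Data.List.Properties using (length-map; reverse-map; unfold-reverse;
  filter-all; filter-none; filter-accept; filter-reject)
open import Data.List.Relation.Unary.All as All using (All; []; _∷_)
import Data.List.Relation.Unary.All.Properties as All
open import Data.List.Relation.Unary.AllPairs as AllPairs using (AllPairs; []; _∷_)
import Data.List.Relation.Unary.AllPairs.Properties as AllPairs
open import Data.List.Relation.Binary.Permutation.Propositional.Properties using (↭-length; filter-↭; ↭-reverse)
open import Data.Vec using ([]; _∷_; lookup; _[_]≔_)
open import Data.Vec.Properties using (lookup∘update; lookup∘update′; []≔-commutes; []≔-idempotent;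
  []≔-lookup; []=⇒lookup; lookup⇒[]=)
open import Data.Vec.Functional using (Vector; insertAt; removeAt) renaming (_∷_ to _∷ᵥ_)
open import Data.Vec.Functional.Properties using (insertAt-lookup; insertAt-punchIn)
open import Data.Fin using (Fin; zero; suc; toℕ; fromℕ; punchIn; punchOut; _≟_)
open import Data.Fin.Properties using (any?; toℕ-fromℕ; ≤fromℕ; punchInᵢ≢i; punchIn-punchOut)
open import Data.Fin.Subset using (Subset; ∣_∣; _∉_; _∪_; ⁅_⁆)
open import Data.Fin.Subset.Properties using (∪-identityʳ)
open import Data.Product using (∃-syntax; _×_; _,_; proj₁; proj₂)
open import Data.Sum using (inj₁; inj₂; [_,_]′)
open import Data.Empty using (⊥-elim)
open import Function using (_∘_; id)
open import Function.Bundles using (_⇔_; mk⇔)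
open import Relation.Binary.PropositionalEquality
open import Relation.Nullary using (¬_; yes; no; contradiction)
open import Relation.Nullary.Decidable using (¬?; decidable-stable)

private variable
  k n r c d d′ x : ℕ
  xs ys : List ℕ

-- Integer vectors and kernels of integer matrices

Σℤ≡∑ : ∀ k (f : Vector ℤ k) → Σℤ k f ≡ ∑ f
Σℤ≡∑ zero    f = refl
Σℤ≡∑ (suc k) f = cong (f zero +ℤ_) (Σℤ≡∑ k (f ∘ suc))

∑-zero : (f : Vector ℤ k) → (∀ i → f i ≡ 0ℤ) → ∑ f ≡ 0ℤ
∑-zero {k} f f≗0 = trans (sum-cong-≗ f≗0) (sum-replicate-zero k)

∑-supported : (f : Vector ℤ (suc n)) (i : Fin (suc n)) → (∀ k → k ≢ i → f k ≡ 0ℤ) → ∑ f ≡ f i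
∑-supported f i f≡0 = trans (sum-remove {i = i} f)
  (trans (cong (f i +ℤ_) (∑-zero _ (λ q → f≡0 (punchIn i q) (punchInᵢ≢i i q)))) (ℤP.+-identityʳ (f i)))

infix 7 _·_
_·_ : Vector ℤ k → Vector ℤ k → ℤ
u · v = ∑ (λ i → u i *ℤ v i)

·-onesʳ : (u : Vector ℤ k) → u · (λ _ → 1ℤ) ≡ ∑ u
·-onesʳ u = sum-cong-≗ (ℤP.*-identityʳ ∘ u)

·-scaleˡ : ∀ a (u v : Vector ℤ k) → (λ i → a *ℤ u i) · v ≡ a *ℤ (u · v)
·-scaleˡ a u v = trans (sum-cong-≗ (λ i → ℤP.*-assoc a (u i) (v i))) (sym (*-distribˡ-sum a (λ i → u i *ℤ v i)))

·-combinationʳ : ∀ a b (u v w : Vector ℤ k) →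
  u · (λ i → a *ℤ v i - b *ℤ w i) ≡ a *ℤ (u · v) - b *ℤ (u · w)
·-combinationʳ a b u v w = begin
  u · (λ i → a *ℤ v i - b *ℤ w i)
    ≡⟨ sum-cong-≗ (λ i → regroup a b (u i) (v i) (w i)) ⟩
  ∑ (λ i → a *ℤ (u i *ℤ v i) +ℤ (- b) *ℤ (u i *ℤ w i))
    ≡⟨ ∑-distrib-+ (λ i → a *ℤ (u i *ℤ v i)) (λ i → (- b) *ℤ (u i *ℤ w i)) ⟩
  ∑ (λ i → a *ℤ (u i *ℤ v i)) +ℤ ∑ (λ i → (- b) *ℤ (u i *ℤ w i))
    ≡⟨ sym (cong₂ _+ℤ_ (*-distribˡ-sum a (λ i → u i *ℤ v i)) (*-distribˡ-sum (- b) (λ i → u i *ℤ w i))) ⟩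
  a *ℤ (u · v) +ℤ (- b) *ℤ (u · w)
    ≡⟨ cong (a *ℤ (u · v) +ℤ_) (sym (ℤP.neg-distribˡ-* b (u · w))) ⟩
  a *ℤ (u · v) - b *ℤ (u · w) ∎
  where
  open ≡-Reasoning
  regroup : ∀ a b x y z → x *ℤ (a *ℤ y - b *ℤ z) ≡ a *ℤ (x *ℤ y) +ℤ (- b) *ℤ (x *ℤ z)
  regroup = solveℤ

·-transpose : (l : Vector ℤ k) (w : Vector ℤ n) (M : Fin k → Vector ℤ n) →
  l · (λ i → w · M i) ≡ w · (λ j → l · (λ i → M i j))
·-transpose l w M = begin
  ∑ (λ i → l i *ℤ ∑ (λ j → w j *ℤ M i j))   ≡⟨ sum-cong-≗ (λ i → *-distribˡ-sum (l i) (λ j → w j *ℤ M i j)) ⟩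
  ∑ (λ i → ∑ (λ j → l i *ℤ (w j *ℤ M i j)))  ≡⟨ sum-cong-≗ (λ i → sum-cong-≗ (λ j → swap (l i) (w j) (M i j))) ⟩
  ∑ (λ i → ∑ (λ j → w j *ℤ (l i *ℤ M i j)))  ≡⟨ ∑-comm (λ i j → w j *ℤ (l i *ℤ M i j)) ⟩
  ∑ (λ j → ∑ (λ i → w j *ℤ (l i *ℤ M i j)))  ≡⟨ sum-cong-≗ (λ j → sym (*-distribˡ-sum (w j) (λ i → l i *ℤ M i j))) ⟩
  ∑ (λ j → w j *ℤ ∑ (λ i → l i *ℤ M i j))   ∎
  where
  open ≡-Reasoning
  swap : ∀ x y z → x *ℤ (y *ℤ z) ≡ y *ℤ (x *ℤ z)
  swap = solveℤ

·-insertAt : (u : Vector ℤ (suc k)) (j : Fin (suc (suc k))) (x : ℤ) (v : Vector ℤ (suc (suc k))) →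
  insertAt u j x · v ≡ x *ℤ v j +ℤ u · removeAt v j
·-insertAt u j x v = begin
  insertAt u j x · v
    ≡⟨ sum-remove {i = j} (λ i → insertAt u j x i *ℤ v i) ⟩
  insertAt u j x j *ℤ v j +ℤ ∑ (λ q → insertAt u j x (punchIn j q) *ℤ v (punchIn j q))
    ≡⟨ cong₂ (λ y z → y *ℤ v j +ℤ z) (insertAt-lookup u j x)
             (sum-cong-≗ (λ q → cong (_*ℤ v (punchIn j q)) (insertAt-punchIn u j x q))) ⟩
  x *ℤ v j +ℤ u · removeAt v j ∎
  where open ≡-Reasoning

Nontrivial : Vector ℤ k → Set
Nontrivial l = ∃[ i ] l i ≢ 0ℤ

Kernel : (Fin r → Vector ℤ k) → Vector ℤ k → Set
Kernel M l = ∀ ρ → l · M ρ ≡ 0ℤ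

-- Fraction-free Gaussian elimination of column j below the pivot M zero j.
eliminate : (M : Fin (suc r) → Vector ℤ (suc (suc c))) (j : Fin (suc (suc c))) → Fin r → Vector ℤ (suc c)
eliminate M j ρ q = M zero j *ℤ M (suc ρ) (punchIn j q) - M (suc ρ) j *ℤ M zero (punchIn j q)

pivot-step : (M : Fin (suc r) → Vector ℤ (suc (suc c))) (j : Fin (suc (suc c))) → M zero j ≢ 0ℤ →
  (μ : Vector ℤ (suc c)) → Nontrivial μ → Kernel (eliminate M j) μ →
  ∃[ l ] Nontrivial l × Kernel M l
pivot-step M j a≢0 μ (q₀ , μq₀≢0) μ∈ker = l , (punchIn j q₀ , lq₀≢0) , l∈ker
  where
  a = M zero j
  s = μ · removeAt (M zero) j
  l = insertAt (λ q → a *ℤ μ q) j (- s)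

  l·-expand : ∀ v → l · v ≡ (- s) *ℤ v j +ℤ a *ℤ (μ · removeAt v j)
  l·-expand v = trans (·-insertAt _ j (- s) v) (cong ((- s) *ℤ v j +ℤ_) (·-scaleˡ a μ (removeAt v j)))

  l∈ker : Kernel M l
  l∈ker zero = trans (l·-expand (M zero)) (cancel s a)
    where
    cancel : ∀ s a → (- s) *ℤ a +ℤ a *ℤ s ≡ 0ℤ
    cancel = solveℤ
  l∈ker (suc ρ) = begin
    l · M (suc ρ)                   ≡⟨ l·-expand (M (suc ρ)) ⟩
    (- s) *ℤ b +ℤ a *ℤ (μ · row′)   ≡⟨ reorder s b a (μ · row′) ⟩
    a *ℤ (μ · row′) - b *ℤ s        ≡⟨ sym (·-combinationʳ a b μ row′ (removeAt (M zero) j)) ⟩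
    μ · eliminate M j ρ             ≡⟨ μ∈ker ρ ⟩
    0ℤ                              ∎
    where
    open ≡-Reasoning
    b = M (suc ρ) j
    row′ = removeAt (M (suc ρ)) j
    reorder : ∀ s b a t → (- s) *ℤ b +ℤ a *ℤ t ≡ a *ℤ t - b *ℤ s
    reorder = solveℤ

  lq₀≢0 : l (punchIn j q₀) ≢ 0ℤ
  lq₀≢0 lq₀≡0 = [ a≢0 , μq₀≢0 ]′ (ℤP.i*j≡0⇒i≡0∨j≡0 a (trans (sym (insertAt-punchIn _ j (- s) q₀)) lq₀≡0))

kernel : r ≤ c → (M : Fin r → Vector ℤ (suc c)) → ∃[ l ] Nontrivial l × Kernel M l
kernel {zero} _ M = (λ _ → 1ℤ) , (zero , λ ()) , λ ()
kernel {suc r} {suc c} (s≤s r≤c) M with any? (λ j → ¬? (M zero j ℤP.≟ 0ℤ))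
... | yes (j , a≢0) =
  let μ , μ≢0 , μ∈ker = kernel r≤c (eliminate M j) in pivot-step M j a≢0 μ μ≢0 μ∈ker
... | no no-pivot =
  let l , l≢0 , l∈ker = kernel (m≤n⇒m≤1+n r≤c) (M ∘ suc) in
  l , l≢0 , λ { zero → ∑-zero _ (λ i → trans (cong (l i *ℤ_) (row₀≡0 i)) (ℤP.*-zeroʳ (l i)))
              ; (suc ρ) → l∈ker ρ }
  where
  row₀≡0 : ∀ i → M zero i ≡ 0ℤ
  row₀≡0 i = decidable-stable (M zero i ℤP.≟ 0ℤ) (λ ne → no-pivot (i , ne))

-- Affine independence of 0/1-points

coord : (Fin k → Subset n) → Fin n → Vector ℤ k
coord F j i = e (F i) j

e-lookup : (A : Subset n) (j : Fin n) {b : Bool} → lookup A j ≡ b → e A j ≡ (if b then 1ℤ else 0ℤ)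
e-lookup A j = cong (λ b → if b then 1ℤ else 0ℤ)

nontrivial-relation⇒¬AffinelyIndependent : (F : Fin (suc k) → Subset n) (l : Vector ℤ (suc k)) →
  Nontrivial l → ∑ l ≡ 0ℤ → (∀ j → l · coord F j ≡ 0ℤ) → ¬ AffinelyIndependent F
nontrivial-relation⇒¬AffinelyIndependent {k} F l (i , lᵢ≢0) ∑l≡0 l·F≡0 ai =
  lᵢ≢0 (ai l (trans (Σℤ≡∑ (suc k) l) ∑l≡0)
            (λ j → trans (Σℤ≡∑ (suc k) (λ i → l i *ℤ coord F j i)) (l·F≡0 j)) i)

trivial-relations⇒AffinelyIndependent : (F : Fin (suc k) → Subset n) →
  (∀ l → ∑ l ≡ 0ℤ → (∀ j → l · coord F j ≡ 0ℤ) → ∀ i → l i ≡ 0ℤ) → AffinelyIndependent F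
trivial-relations⇒AffinelyIndependent {k} F only-trivial l ∑l≡0 l·F≡0 = only-trivial l
  (trans (sym (Σℤ≡∑ (suc k) l)) ∑l≡0)
  (λ j → trans (sym (Σℤ≡∑ (suc k) (λ i → l i *ℤ coord F j i))) (l·F≡0 j))

affine-kernel : r ≤ k → (M : Fin r → Vector ℤ (suc (suc k))) →
  ∃[ l ] Nontrivial l × ∑ l ≡ 0ℤ × Kernel M l
affine-kernel r≤k M =
  let l , l≢0 , l∈ker = kernel (s≤s r≤k) ((λ _ → 1ℤ) ∷ᵥ M)
  in l , l≢0 , trans (sym (·-onesʳ l)) (l∈ker zero) , l∈ker ∘ suc

¬AffinelyIndependent-suc-suc : (F : Fin (suc (suc n)) → Subset n) → ¬ AffinelyIndependent F
¬AffinelyIndependent-suc-suc F =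
  let l , l≢0 , ∑l≡0 , l∈ker = affine-kernel ≤-refl (coord F)
  in nontrivial-relation⇒¬AffinelyIndependent F l l≢0 ∑l≡0 l∈ker

-- The hyperplane equation expresses coordinate j through the others, so a relation on
-- those coordinates is a relation on coordinate j as well.
hyperplane-relation : (F : Fin k → Subset (suc n)) (w : Vector ℤ (suc n)) (j : Fin (suc n)) (c : ℤ) →
  w j ≢ 0ℤ → (∀ i → w · e (F i) ≡ c) → (l : Vector ℤ k) → ∑ l ≡ 0ℤ →
  (∀ q → l · coord F (punchIn j q) ≡ 0ℤ) → ∀ j′ → l · coord F j′ ≡ 0ℤ
hyperplane-relation F w j c wⱼ≢0 F⊆H l ∑l≡0 l·F≡0 j′ with j ≟ j′
... | no j≢j′  = subst (λ j′ → l · coord F j′ ≡ 0ℤ) (punchIn-punchOut j≢j′) (l·F≡0 (punchOut j≢j′))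
... | yes refl = [ ⊥-elim ∘ wⱼ≢0 , id ]′ (ℤP.i*j≡0⇒i≡0∨j≡0 (w j) wⱼ*l·Fⱼ≡0)
  where
  wⱼ*l·Fⱼ≡0 : w j *ℤ (l · coord F j) ≡ 0ℤ
  wⱼ*l·Fⱼ≡0 = begin
    w j *ℤ (l · coord F j)
      ≡⟨ sym (ℤP.+-identityʳ _) ⟩
    w j *ℤ (l · coord F j) +ℤ 0ℤ
      ≡⟨ cong (w j *ℤ (l · coord F j) +ℤ_) (sym (∑-zero _ (λ q →
           trans (cong (w (punchIn j q) *ℤ_) (l·F≡0 q)) (ℤP.*-zeroʳ (w (punchIn j q)))))) ⟩
    w j *ℤ (l · coord F j) +ℤ ∑ (λ q → w (punchIn j q) *ℤ (l · coord F (punchIn j q)))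
      ≡⟨ sym (sum-remove {i = j} (λ k → w k *ℤ (l · coord F k))) ⟩
    w · (λ k → l · coord F k)
      ≡⟨ sym (·-transpose l w (e ∘ F)) ⟩
    l · (λ i → w · e (F i))
      ≡⟨ sum-cong-≗ (λ i → cong (l i *ℤ_) (F⊆H i)) ⟩
    ∑ (λ i → l i *ℤ c)
      ≡⟨ sym (*-distribʳ-sum c l) ⟩
    ∑ l *ℤ c
      ≡⟨ cong (_*ℤ c) ∑l≡0 ⟩
    0ℤ *ℤ c
      ≡⟨ ℤP.*-zeroˡ c ⟩
    0ℤ ∎
    where open ≡-Reasoning

hyperplane⇒¬AffinelyIndependent : (F : Fin (suc n) → Subset n) (w : Vector ℤ n) (j : Fin n) (c : ℤ) →
  w j ≢ 0ℤ → (∀ i → w · e (F i) ≡ c) → ¬ AffinelyIndependent F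
hyperplane⇒¬AffinelyIndependent {suc m} F w j c wⱼ≢0 F⊆H =
  let l , l≢0 , ∑l≡0 , l·F≡0 = affine-kernel ≤-refl (coord F ∘ punchIn j)
  in nontrivial-relation⇒¬AffinelyIndependent F l l≢0 ∑l≡0 (hyperplane-relation F w j c wⱼ≢0 F⊆H l ∑l≡0 l·F≡0)

AffinelyIndependent-tail : (F : Fin (suc (suc k)) → Subset n) → AffinelyIndependent F → AffinelyIndependent (F ∘ suc)
AffinelyIndependent-tail {k} F ai l ∑l≡0 l·F≡0 i = ai (0ℤ ∷ᵥ l)
  (trans (ℤP.+-identityˡ _) ∑l≡0)
  (λ j → let l·Fⱼ = Σℤ (suc k) (λ i → l i *ℤ e (F (suc i)) j) in
         trans (cong (_+ℤ l·Fⱼ) (ℤP.*-zeroˡ (e (F zero) j))) (trans (ℤP.+-identityˡ l·Fⱼ) (l·F≡0 j)))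
  (suc i)

module _ {S T : Subset n} where

  AffinelyIndependent-size≤dim : DimP S T d → (G : Fin (suc d′) → Subset n) →
    (∀ i → InInterval S T (G i)) → AffinelyIndependent G → d′ ≤ d
  AffinelyIndependent-size≤dim {d′ = zero} _ _ _ _ = z≤n
  AffinelyIndependent-size≤dim {d′ = suc d′} dim G G⊆I ai
    with m≤n⇒m<n∨m≡n (AffinelyIndependent-size≤dim dim (G ∘ suc) (G⊆I ∘ suc) (AffinelyIndependent-tail G ai))
  ... | inj₁ d′<d = d′<d
  ... | inj₂ refl = ⊥-elim (proj₂ dim G G⊆I ai)

  DimP-unique : DimP S T d → DimP S T d′ → d ≡ d′
  DimP-unique dim dim′ = ≤-antisym (bound dim′ dim) (bound dim dim′)
    where
    bound : DimP S T d → DimP S T d′ → d′ ≤ d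
    bound dim ((G , G⊆I , ai) , _) = AffinelyIndependent-size≤dim dim G G⊆I ai

-- The Gale order through counts

count≥ : ℕ → List ℕ → ℕ
count≥ t xs = length (filter (t ≤?_) xs)

count≥-zero : ∀ xs → count≥ 0 xs ≡ length xs
count≥-zero xs = cong length (filter-all (0 ≤?_) (All.universal (λ _ → z≤n) xs))

count≥-accept : ∀ {t} → t ≤ x → count≥ t (x ∷ xs) ≡ suc (count≥ t xs)
count≥-accept {t = t} t≤x = cong length (filter-accept (t ≤?_) t≤x)

count≥-reject : ∀ {t} → ¬ t ≤ x → count≥ t (x ∷ xs) ≡ count≥ t xs
count≥-reject {t = t} t≰x = cong length (filter-reject (t ≤?_) t≰x)

count≥-below : ∀ {t} zs → All (_≤ x) zs → x < t → count≥ t zs ≡ 0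
count≥-below {t = t} zs zs≤x x<t =
  cong length (filter-none (t ≤?_) (All.map (λ z≤x t≤z → <⇒≱ x<t (≤-trans t≤z z≤x)) zs≤x))

count≥-map-suc : ∀ t xs → count≥ (suc t) (map suc xs) ≡ count≥ t xs
count≥-map-suc t [] = refl
count≥-map-suc t (x ∷ xs) with t ≤? x
... | yes t≤x = trans (count≥-accept (s≤s t≤x)) (trans (cong suc (count≥-map-suc t xs)) (sym (count≥-accept t≤x)))
... | no  t≰x = trans (count≥-reject (t≰x ∘ s≤s⁻¹)) (trans (count≥-map-suc t xs) (sym (count≥-reject t≰x)))

count≥-reverse : ∀ t xs → count≥ t (reverse xs) ≡ count≥ t xs
count≥-reverse t xs = ↭-length (filter-↭ (t ≤?_) (↭-reverse xs))

TopLe⇒count≥ : TopLe xs ys → ∀ t → count≥ t xs ≤ count≥ t ys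
TopLe⇒count≥ nil t = z≤n
TopLe⇒count≥ {x ∷ xs} {y ∷ ys} (cons x≤y xs≤ys) t with t ≤? x | t ≤? y
... | yes t≤x | yes t≤y = subst₂ _≤_ (sym (count≥-accept t≤x)) (sym (count≥-accept t≤y)) (s≤s (TopLe⇒count≥ xs≤ys t))
... | yes t≤x | no  t≰y = contradiction (≤-trans t≤x x≤y) t≰y
... | no  t≰x | yes t≤y = subst₂ _≤_ (sym (count≥-reject t≰x)) (sym (count≥-accept t≤y)) (m≤n⇒m≤1+n (TopLe⇒count≥ xs≤ys t))
... | no  t≰x | no  t≰y = subst₂ _≤_ (sym (count≥-reject t≰x)) (sym (count≥-reject t≰y)) (TopLe⇒count≥ xs≤ys t)

count≥⇒TopLe : AllPairs _≥_ xs → AllPairs _≥_ ys → (∀ t → count≥ t xs ≤ count≥ t ys) → TopLe xs ys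
count≥⇒TopLe [] _ _ = nil
count≥⇒TopLe {x ∷ xs} {[]} _ _ counts with () ← subst (_≤ 0) (count≥-accept {xs = xs} (≤-refl {x})) (counts x)
count≥⇒TopLe {x ∷ xs} {y ∷ ys} (xs≤x ∷ xs↓) (ys≤y ∷ ys↓) counts with x ≤? y
... | yes x≤y = cons x≤y (count≥⇒TopLe xs↓ ys↓ tail-counts)
  where
  tail-counts : ∀ t → count≥ t xs ≤ count≥ t ys
  tail-counts t with t ≤? x
  ... | no  t≰x = subst (_≤ count≥ t ys) (sym (count≥-below xs xs≤x (≰⇒> t≰x))) z≤n
  ... | yes t≤x = s≤s⁻¹ (subst₂ _≤_ (count≥-accept t≤x) (count≥-accept (≤-trans t≤x x≤y)) (counts t))
... | no x≰y with () ← subst₂ _≤_ (count≥-accept {xs = xs} (≤-refl {x}))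
                                  (count≥-below (y ∷ ys) (≤-refl ∷ ys≤y) (≰⇒> x≰y)) (counts x)

-- countAbove p A = #{a ∈ A : a > p}, elements being numbered from 1
countAbove : ℕ → Subset n → ℕ
countAbove zero    A       = ∣ A ∣
countAbove (suc p) []      = 0
countAbove (suc p) (_ ∷ A) = countAbove p A

length-elemsInc : (A : Subset n) → length (elemsInc A) ≡ ∣ A ∣
length-elemsInc []          = refl
length-elemsInc (true  ∷ A) = cong suc (trans (length-map suc (elemsInc A)) (length-elemsInc A))
length-elemsInc (false ∷ A) = trans (length-map suc (elemsInc A)) (length-elemsInc A)

-- Since every element is ≥ 1, counting the elements ≥ 0 and ≥ 1 gives the same number.
count≥-elemsInc : ∀ t (A : Subset n) → count≥ t (elemsInc A) ≡ countAbove (pred t) A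
count≥-elemsInc zero          A           = trans (count≥-zero (elemsInc A)) (length-elemsInc A)
count≥-elemsInc (suc zero)    []          = refl
count≥-elemsInc (suc (suc t)) []          = refl
count≥-elemsInc (suc zero)    (true  ∷ A) = cong suc (trans (count≥-map-suc 0 (elemsInc A)) (count≥-elemsInc 0 A))
count≥-elemsInc (suc (suc t)) (true  ∷ A) = trans (count≥-map-suc (suc t) (elemsInc A)) (count≥-elemsInc (suc t) A)
count≥-elemsInc (suc zero)    (false ∷ A) = trans (count≥-map-suc 0 (elemsInc A)) (count≥-elemsInc 0 A)
count≥-elemsInc (suc (suc t)) (false ∷ A) = trans (count≥-map-suc (suc t) (elemsInc A)) (count≥-elemsInc (suc t) A)

count≥-elemsDesc : ∀ t (A : Subset n) → count≥ t (elemsDesc A) ≡ countAbove (pred t) A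
count≥-elemsDesc t A = trans (count≥-reverse t (elemsInc A)) (count≥-elemsInc t A)

elemsDesc-descending : (A : Subset n) → AllPairs _≥_ (elemsDesc A)
elemsDesc-descending [] = []
elemsDesc-descending (true ∷ A) =
  subst (AllPairs _≥_) (sym (trans (unfold-reverse 1 (map suc (elemsInc A))) (cong (_∷ʳ 1) (sym (reverse-map suc (elemsInc A))))))
    (AllPairs.++⁺ (AllPairs.map⁺ (AllPairs.map s≤s (elemsDesc-descending A))) ([] ∷ [])
      (All.map⁺ (All.universal (λ _ → s≤s z≤n ∷ []) (elemsDesc A))))
elemsDesc-descending (false ∷ A) =
  subst (AllPairs _≥_) (reverse-map suc (elemsInc A))
    (AllPairs.map⁺ (AllPairs.map s≤s (elemsDesc-descending A)))

≤G⇒countAbove : {A B : Subset n} → A ≤G B → ∀ p → countAbove p A ≤ countAbove p B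
≤G⇒countAbove {A = A} {B} A≤B p =
  subst₂ _≤_ (count≥-elemsDesc (suc p) A) (count≥-elemsDesc (suc p) B) (TopLe⇒count≥ A≤B (suc p))

countAbove⇒≤G : {A B : Subset n} → (∀ p → countAbove p A ≤ countAbove p B) → A ≤G B
countAbove⇒≤G {A = A} {B} counts = count≥⇒TopLe (elemsDesc-descending A) (elemsDesc-descending B)
  (λ t → subst₂ _≤_ (sym (count≥-elemsDesc t A)) (sym (count≥-elemsDesc t B)) (counts (pred t)))

-- Insertion and the rank ℓ

countAbove-insert : (A : Subset n) (c : Fin n) → lookup A c ≡ false →
  ∀ {p} → p ≤ toℕ c → countAbove p (A [ c ]≔ true) ≡ suc (countAbove p A)
countAbove-insert (false ∷ A) zero    refl z≤n = refl
countAbove-insert (true  ∷ A) (suc c) c∉A {zero}  _   = cong suc (countAbove-insert A c c∉A z≤n)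
countAbove-insert (false ∷ A) (suc c) c∉A {zero}  _   = countAbove-insert A c c∉A z≤n
countAbove-insert (x     ∷ A) (suc c) c∉A {suc p} p≤c = countAbove-insert A c c∉A (s≤s⁻¹ p≤c)

countAbove-update-below : (A : Subset n) (c : Fin n) (b : Bool) →
  ∀ {p} → toℕ c < p → countAbove p (A [ c ]≔ b) ≡ countAbove p A
countAbove-update-below (x ∷ A) zero    b {suc p} _   = refl
countAbove-update-below (x ∷ A) (suc c) b {suc p} c<p = countAbove-update-below A c b (s≤s⁻¹ c<p)

≤G-refl : (A : Subset n) → A ≤G A
≤G-refl A = countAbove⇒≤G {A = A} (λ p → ≤-refl)

≤G-insert : (A : Subset n) (c : Fin n) → lookup A c ≡ false → A ≤G (A [ c ]≔ true)
≤G-insert A c c∉A = countAbove⇒≤G counts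
  where
  counts : ∀ p → countAbove p A ≤ countAbove p (A [ c ]≔ true)
  counts p with p ≤? toℕ c
  ... | yes p≤c = subst (countAbove p A ≤_) (sym (countAbove-insert A c c∉A p≤c)) (n≤1+n _)
  ... | no  p≰c = subst (countAbove p A ≤_) (sym (countAbove-update-below A c true (≰⇒> p≰c))) ≤-refl

≤G-insert-mono : (A : Subset n) (c d : Fin n) → lookup A c ≡ false → lookup A d ≡ false →
  toℕ c ≤ toℕ d → (A [ c ]≔ true) ≤G (A [ d ]≔ true)
≤G-insert-mono A c d c∉A d∉A c≤d = countAbove⇒≤G counts
  where
  counts : ∀ p → countAbove p (A [ c ]≔ true) ≤ countAbove p (A [ d ]≔ true)
  counts p with p ≤? toℕ c | p ≤? toℕ d
  ... | yes p≤c | _ = subst₂ _≤_ (sym (countAbove-insert A c c∉A p≤c))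
                                 (sym (countAbove-insert A d d∉A (≤-trans p≤c c≤d))) ≤-refl
  ... | no  p≰c | yes p≤d = subst₂ _≤_ (sym (countAbove-update-below A c true (≰⇒> p≰c)))
                                       (sym (countAbove-insert A d d∉A p≤d)) (n≤1+n _)
  ... | no  p≰c | no  p≰d = subst₂ _≤_ (sym (countAbove-update-below A c true (≰⇒> p≰c)))
                                       (sym (countAbove-update-below A d true (≰⇒> p≰d))) ≤-refl

[]≔-reinsert : (A : Subset n) (c : Fin n) → lookup A c ≡ true → (A [ c ]≔ false) [ c ]≔ true ≡ A
[]≔-reinsert A c c∈A = trans ([]≔-idempotent A c) (trans (cong (A [ c ]≔_) (sym c∈A)) ([]≔-lookup A c))

≤G-remove : (B : Subset n) (c : Fin n) → lookup B c ≡ true → (B [ c ]≔ false) ≤G B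
≤G-remove B c c∈B =
  subst ((B [ c ]≔ false) ≤G_) ([]≔-reinsert B c c∈B) (≤G-insert (B [ c ]≔ false) c (lookup∘update c B false))

sum-map-suc : ∀ xs → sum (map suc xs) ≡ length xs + sum xs
sum-map-suc []       = refl
sum-map-suc (x ∷ xs) = trans (cong (suc x +_) (sum-map-suc xs)) (shuffle x (length xs) (sum xs))
  where
  shuffle : ∀ a b c → suc a + (b + c) ≡ suc b + (a + c)
  shuffle = solveℕ

-- The elements of b ∷ A are the successors of those of A, and possibly 1.
ℓ-∷ : ∀ b (A : Subset n) → ℓ (b ∷ A) ≡ ∣ b ∷ A ∣ + ℓ A
ℓ-∷ true  A = cong suc (trans (sum-map-suc (elemsInc A)) (cong (_+ ℓ A) (length-elemsInc A)))
ℓ-∷ false A = trans (sum-map-suc (elemsInc A)) (cong (_+ ℓ A) (length-elemsInc A))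

ℓ-insert : (A : Subset n) (c : Fin n) → lookup A c ≡ false → ℓ (A [ c ]≔ true) ≡ ℓ A + suc (toℕ c)
ℓ-insert (false ∷ A) zero refl = begin
  ℓ (true ∷ A)             ≡⟨ ℓ-∷ true A ⟩
  suc (∣ A ∣ + ℓ A)        ≡⟨ cong suc (sym (ℓ-∷ false A)) ⟩
  suc (ℓ (false ∷ A))      ≡⟨ +-comm 1 (ℓ (false ∷ A)) ⟩
  ℓ (false ∷ A) + 1        ∎
  where open ≡-Reasoning
ℓ-insert (x ∷ A) (suc c) c∉A = begin
  ℓ (x ∷ A [ c ]≔ true)
    ≡⟨ ℓ-∷ x (A [ c ]≔ true) ⟩
  ∣ x ∷ A [ c ]≔ true ∣ + ℓ (A [ c ]≔ true)
    ≡⟨ cong₂ _+_ (countAbove-insert (x ∷ A) (suc c) c∉A z≤n) (ℓ-insert A c c∉A) ⟩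
  suc ∣ x ∷ A ∣ + (ℓ A + suc (toℕ c))
    ≡⟨ shuffle ∣ x ∷ A ∣ (ℓ A) (toℕ c) ⟩
  (∣ x ∷ A ∣ + ℓ A) + suc (suc (toℕ c))
    ≡⟨ cong (_+ suc (suc (toℕ c))) (sym (ℓ-∷ x A)) ⟩
  ℓ (x ∷ A) + suc (suc (toℕ c)) ∎
  where
  open ≡-Reasoning
  shuffle : ∀ a b c → suc a + (b + suc c) ≡ (a + b) + suc (suc c)
  shuffle = solveℕ

+-≤-≡⇒≡ : ∀ {a b c d} → a ≤ c → b ≤ d → a + b ≡ c + d → a ≡ c × b ≡ d
+-≤-≡⇒≡ {a} {b} {c} {d} a≤c b≤d a+b≡c+d = a≡c , +-cancelˡ-≡ c b d (subst (λ x → x + b ≡ c + d) a≡c a+b≡c+d)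
  where
  a≡c : a ≡ c
  a≡c = ≤-antisym a≤c (+-cancelʳ-≤ d c a (subst (_≤ a + d) a+b≡c+d (+-monoʳ-≤ a b≤d)))

ℓ-∷-+ : ∀ b (A : Subset n) → ℓ (b ∷ A) + suc n ≡ suc ∣ b ∷ A ∣ + (ℓ A + n)
ℓ-∷-+ {n} b A = trans (cong (_+ suc n) (ℓ-∷ b A)) (shuffle ∣ b ∷ A ∣ (ℓ A) n)
  where
  shuffle : ∀ a b c → a + b + suc c ≡ suc a + (b + c)
  shuffle = solveℕ

-- ℓ A = Σ_p countAbove p A, so ℓ T - ℓ S is the sum of the gaps.
ℓ-gap : (S T : Subset n) → (∀ p → p < n → countAbove p S < countAbove p T) → ℓ S + n ≤ ℓ T
ℓ-gap []      []      _    = z≤n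
ℓ-gap (s ∷ S) (t ∷ T) gaps = subst₂ _≤_ (sym (ℓ-∷-+ s S)) (sym (ℓ-∷ t T))
  (+-mono-≤ (gaps 0 (s≤s z≤n)) (ℓ-gap S T (λ p p<n → gaps (suc p) (s≤s p<n))))

ℓ-gap-tight : (S T : Subset n) → (∀ p → p < n → countAbove p S < countAbove p T) → ℓ S + n ≡ ℓ T →
  ∀ p → p < n → countAbove p T ≡ suc (countAbove p S)
ℓ-gap-tight (s ∷ S) (t ∷ T) gaps ℓS+n≡ℓT p p<n
  with +-≤-≡⇒≡ (gaps 0 (s≤s z≤n)) (ℓ-gap S T (λ p p<n → gaps (suc p) (s≤s p<n)))
         (trans (sym (ℓ-∷-+ s S)) (trans ℓS+n≡ℓT (ℓ-∷ t T)))
ℓ-gap-tight (s ∷ S) (t ∷ T) gaps _ zero    _   | head≡ , _ = sym head≡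
ℓ-gap-tight (s ∷ S) (t ∷ T) gaps _ (suc p) p<n | _ , tail≡ =
  ℓ-gap-tight S T (λ p p<n → gaps (suc p) (s≤s p<n)) tail≡ p (s≤s⁻¹ p<n)

countAbove-suc⇒insert-last : ∀ m (S T : Subset (suc m)) →
  (∀ p → p < suc m → countAbove p T ≡ suc (countAbove p S)) →
  lookup S (fromℕ m) ≡ false × T ≡ S [ fromℕ m ]≔ true
countAbove-suc⇒insert-last zero (false ∷ []) (true  ∷ []) _ = refl , refl
countAbove-suc⇒insert-last zero (false ∷ []) (false ∷ []) steps with () ← steps 0 (s≤s z≤n)
countAbove-suc⇒insert-last zero (true  ∷ []) (true  ∷ []) steps with () ← steps 0 (s≤s z≤n)
countAbove-suc⇒insert-last zero (true  ∷ []) (false ∷ []) steps with () ← steps 0 (s≤s z≤n)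
countAbove-suc⇒insert-last (suc m) (s ∷ S) (t ∷ T) steps
  with countAbove-suc⇒insert-last m S T (λ p p<n → steps (suc p) (s≤s p<n))
... | S-last , refl = S-last , cong (_∷ S [ fromℕ m ]≔ true) (same-head s t (steps 0 (s≤s z≤n)))
  where
  ∣S+m∣ : ∣ S [ fromℕ m ]≔ true ∣ ≡ suc ∣ S ∣
  ∣S+m∣ = countAbove-insert S (fromℕ m) S-last z≤n
  same-head : ∀ s t → ∣ t ∷ S [ fromℕ m ]≔ true ∣ ≡ suc ∣ s ∷ S ∣ → t ≡ s
  same-head true  true  _ = refl
  same-head false false _ = refl
  same-head true  false eq = contradiction (trans (sym ∣S+m∣) eq) (1+n≢n ∘ sym)
  same-head false true  eq = contradiction (trans (sym ∣S+m∣) (suc-injective eq)) 1+n≢n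

-- Linked toric intervals

aboveWeight : ℕ → Vector ℤ n
aboveWeight zero    j       = 1ℤ
aboveWeight (suc p) zero    = 0ℤ
aboveWeight (suc p) (suc j) = aboveWeight p j

countAbove-as-dot : ∀ p (A : Subset n) → ℤ.+ countAbove p A ≡ aboveWeight p · e A
countAbove-as-dot zero    []          = refl
countAbove-as-dot (suc p) []          = refl
countAbove-as-dot zero    (true  ∷ A) rewrite sym (countAbove-as-dot zero A) = refl
countAbove-as-dot zero    (false ∷ A) rewrite sym (countAbove-as-dot zero A) = refl
countAbove-as-dot (suc p) (b     ∷ A) rewrite sym (countAbove-as-dot p A)    = refl

aboveWeight-last : ∀ {p} m → p ≤ m → aboveWeight p (fromℕ m) ≡ 1ℤ
aboveWeight-last m       z≤n       = refl
aboveWeight-last (suc m) (s≤s p≤m) = aboveWeight-last m p≤m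

-- If countAbove p did not grow from S to T, the whole interval would lie in a hyperplane.
linked⇒countAbove-< : ∀ m {S T : Subset (suc m)} → S ≤G T → Linked S T →
  ∀ p → p < suc m → countAbove p S < countAbove p T
linked⇒countAbove-< m {S} {T} S≤T ((F , F⊆I , ai) , _) p (s≤s p≤m)
  with m≤n⇒m<n∨m≡n (≤G⇒countAbove S≤T p)
... | inj₁ S<T = S<T
... | inj₂ S≡T = ⊥-elim (hyperplane⇒¬AffinelyIndependent F (aboveWeight p) (fromℕ m) (ℤ.+ countAbove p S)
                   (subst (_≢ 0ℤ) (sym (aboveWeight-last m p≤m)) (λ ())) F⊆H ai)
  where
  F⊆H : ∀ i → aboveWeight p · e (F i) ≡ ℤ.+ countAbove p S
  F⊆H i = trans (sym (countAbove-as-dot p (F i))) (cong ℤ.+_ (≤-antisym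
    (subst (countAbove p (F i) ≤_) (sym S≡T) (≤G⇒countAbove (proj₂ (F⊆I i)) p))
    (≤G⇒countAbove (proj₁ (F⊆I i)) p)))

module TopExtension (m : ℕ) (S : Subset (suc m)) (S-last : lookup S (fromℕ m) ≡ false) where

  L : Fin (suc m)
  L = fromℕ m

  T : Subset (suc m)
  T = S [ L ]≔ true

  -- The point attached to c when lookup S c ≡ b: add c, or trade c for the top element L.
  point : Fin (suc m) → Bool → Subset (suc m)
  point c false = S [ c ]≔ true
  point c true  = (S [ c ]≔ false) [ L ]≔ true

  family : Fin (suc (suc m)) → Subset (suc m)
  family zero    = S
  family (suc c) = point c (lookup S c)

  member≢L : ∀ {c} → lookup S c ≡ true → c ≢ L
  member≢L c∈S refl with () ← trans (sym c∈S) S-last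

  point-lookup-other : ∀ c b {j} → c ≢ j → L ≢ j → lookup (point c b) j ≡ lookup S j
  point-lookup-other c false c≢j _   = lookup∘update′ (c≢j ∘ sym) S true
  point-lookup-other c true  c≢j L≢j =
    trans (lookup∘update′ (L≢j ∘ sym) (S [ c ]≔ false) true) (lookup∘update′ (c≢j ∘ sym) S false)

  point-lookup-self : ∀ c {b} → lookup S c ≡ b → lookup (point c b) c ≡ not b
  point-lookup-self c {false} _   = lookup∘update c S true
  point-lookup-self c {true}  c∈S =
    trans (lookup∘update′ (member≢L c∈S) (S [ c ]≔ false) true) (lookup∘update c S false)

  point-lookup-L : ∀ c b → c ≢ L → lookup (point c b) L ≡ b
  point-lookup-L c false c≢L = trans (lookup∘update′ (c≢L ∘ sym) S true) S-last
  point-lookup-L c true  _   = lookup∘update L (S [ c ]≔ false) true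

  point∈interval : ∀ c {b} → lookup S c ≡ b → InInterval S T (point c b)
  point∈interval c {false} c∉S = ≤G-insert S c c∉S , ≤G-insert-mono S c L c∉S S-last (≤fromℕ c)
  point∈interval c {true}  c∈S = S≤point , point≤T
    where
    c≢L = member≢L c∈S
    S-c = S [ c ]≔ false
    S≤point : S ≤G (S-c [ L ]≔ true)
    S≤point = subst (_≤G (S-c [ L ]≔ true)) ([]≔-reinsert S c c∈S)
      (≤G-insert-mono S-c c L (lookup∘update c S false) (trans (lookup∘update′ (c≢L ∘ sym) S false) S-last) (≤fromℕ c))
    point≤T : (S-c [ L ]≔ true) ≤G T
    point≤T = subst (_≤G T) ([]≔-commutes S L c (c≢L ∘ sym))
      (≤G-remove T c (trans (lookup∘update′ c≢L S true) c∈S))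

  family⊆interval : ∀ i → InInterval S T (family i)
  family⊆interval zero    = ≤G-refl S , ≤G-insert S L S-last
  family⊆interval (suc c) = point∈interval c refl

  lookup-family-other : ∀ {i j} → i ≢ suc j → j ≢ L → lookup (family i) j ≡ lookup S j
  lookup-family-other {zero}  _   _   = refl
  lookup-family-other {suc c} i≢j j≢L = point-lookup-other c (lookup S c) (i≢j ∘ cong suc) (j≢L ∘ sym)

  lookup-family-self : ∀ j → lookup (family (suc j)) j ≡ not (lookup S j)
  lookup-family-self j = point-lookup-self j refl

  module _ (l : Vector ℤ (suc (suc m))) (∑l≡0 : ∑ l ≡ 0ℤ) (l·F≡0 : ∀ j → l · coord family j ≡ 0ℤ) where

    -- Every point but family (suc j) contains j, so l (suc j) = ∑ l − l · coord family j.
    l-member : ∀ {j} → lookup S j ≡ true → l (suc j) ≡ 0ℤ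
    l-member {j} S-j = begin
      l (suc j)                            ≡⟨ sym (ℤP.+-identityʳ (l (suc j))) ⟩
      l (suc j) +ℤ 0ℤ                      ≡⟨ cong (l (suc j) +ℤ_) (sym others≡0) ⟩
      l (suc j) +ℤ ∑ (l ∘ punchIn (suc j)) ≡⟨ sym (sum-remove {i = suc j} l) ⟩
      ∑ l                                  ≡⟨ ∑l≡0 ⟩
      0ℤ                                   ∎
      where
      open ≡-Reasoning
      lᵢFᵢⱼ : Vector ℤ (suc (suc m))
      lᵢFᵢⱼ i = l i *ℤ coord family j i
      others≡0 : ∑ (l ∘ punchIn (suc j)) ≡ 0ℤ
      others≡0 = begin
        ∑ (l ∘ punchIn (suc j))
          ≡⟨ sum-cong-≗ (λ q → sym (trans (cong (l (punchIn (suc j) q) *ℤ_)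
               (e-lookup (family (punchIn (suc j) q)) j (trans (lookup-family-other (punchInᵢ≢i (suc j) q) (member≢L S-j)) S-j)))
               (ℤP.*-identityʳ (l (punchIn (suc j) q))))) ⟩
        ∑ (lᵢFᵢⱼ ∘ punchIn (suc j))
          ≡⟨ sym (ℤP.+-identityˡ (∑ (lᵢFᵢⱼ ∘ punchIn (suc j)))) ⟩
        0ℤ +ℤ ∑ (lᵢFᵢⱼ ∘ punchIn (suc j))
          ≡⟨ cong (_+ℤ ∑ (lᵢFᵢⱼ ∘ punchIn (suc j)))
               (sym (trans (cong (l (suc j) *ℤ_) (e-lookup (family (suc j)) j (trans (lookup-family-self j) (cong not S-j))))
                           (ℤP.*-zeroʳ (l (suc j))))) ⟩
        lᵢFᵢⱼ (suc j) +ℤ ∑ (lᵢFᵢⱼ ∘ punchIn (suc j))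
          ≡⟨ sym (sum-remove {i = suc j} lᵢFᵢⱼ) ⟩
        l · coord family j
          ≡⟨ l·F≡0 j ⟩
        0ℤ ∎

    l-sole : ∀ j → lookup (family (suc j)) j ≡ true →
      (∀ i → i ≢ suc j → l i *ℤ coord family j i ≡ 0ℤ) → l (suc j) ≡ 0ℤ
    l-sole j self others = begin
      l (suc j)                           ≡⟨ sym (ℤP.*-identityʳ (l (suc j))) ⟩
      l (suc j) *ℤ 1ℤ                     ≡⟨ cong (l (suc j) *ℤ_) (sym (e-lookup (family (suc j)) j self)) ⟩
      l (suc j) *ℤ coord family j (suc j) ≡⟨ sym (∑-supported (λ i → l i *ℤ coord family j i) (suc j) others) ⟩
      l · coord family j                  ≡⟨ l·F≡0 j ⟩
      0ℤ                                  ∎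
      where open ≡-Reasoning

    l-nonmember : ∀ {j} → lookup S j ≡ false → j ≢ L → l (suc j) ≡ 0ℤ
    l-nonmember {j} S-j j≢L = l-sole j (trans (lookup-family-self j) (cong not S-j)) others
      where
      others : ∀ i → i ≢ suc j → l i *ℤ coord family j i ≡ 0ℤ
      others i i≢j = trans (cong (l i *ℤ_) (e-lookup (family i) j (trans (lookup-family-other i≢j j≢L) S-j)))
                           (ℤP.*-zeroʳ (l i))

    -- Besides family (suc L) = T, only the points trading a member of S for L contain L, and their weights vanish.
    l-last : l (suc L) ≡ 0ℤ
    l-last = l-sole L (trans (lookup-family-self L) (cong not S-last)) others
      where
      others : ∀ i → i ≢ suc L → l i *ℤ coord family L i ≡ 0ℤ
      others zero    _ = trans (cong (l zero *ℤ_) (e-lookup S L S-last)) (ℤP.*-zeroʳ (l zero))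
      others (suc c) c≢L with lookup S c in S-c
      ... | true  = trans (cong (_*ℤ e (point c true) L) (l-member S-c)) (ℤP.*-zeroˡ (e (point c true) L))
      ... | false = trans (cong (l (suc c) *ℤ_) (e-lookup (point c false) L (point-lookup-L c false (c≢L ∘ cong suc))))
                          (ℤP.*-zeroʳ (l (suc c)))

    l-suc : ∀ c → l (suc c) ≡ 0ℤ
    l-suc c with lookup S c in S-c | c ≟ L
    ... | true  | _        = l-member S-c
    ... | false | yes refl = l-last
    ... | false | no  c≢L  = l-nonmember S-c c≢L

    l≡0 : ∀ i → l i ≡ 0ℤ
    l≡0 zero    = trans (sym (ℤP.+-identityʳ (l zero)))
                    (trans (cong (l zero +ℤ_) (sym (∑-zero (l ∘ suc) l-suc))) ∑l≡0)
    l≡0 (suc c) = l-suc c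

  family-independent : AffinelyIndependent family
  family-independent = trivial-relations⇒AffinelyIndependent family l≡0

  linked : Linked S T
  linked = (family , family⊆interval , family-independent) , (λ G _ → ¬AffinelyIndependent-suc-suc G)

  toric : Toric S T
  toric = suc m , linked , sym (trans (ℓ-insert S L S-last) (cong (λ k → ℓ S + suc k) (toℕ-fromℕ m)))

∪-⁅⁆ : (A : Subset n) (i : Fin n) → A ∪ ⁅ i ⁆ ≡ A [ i ]≔ true
∪-⁅⁆ (x ∷ A) zero    = cong₂ _∷_ (∨-zeroʳ x) (∪-identityʳ A)
∪-⁅⁆ (x ∷ A) (suc i) = cong₂ _∷_ (∨-identityʳ x) (∪-⁅⁆ A i)

∉⇒lookup≡false : {A : Subset n} {i : Fin n} → i ∉ A → lookup A i ≡ false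
∉⇒lookup≡false {A = A} {i} i∉A = ¬-not (i∉A ∘ lookup⇒[]= i A)

lookup≡false⇒∉ : {A : Subset n} {i : Fin n} → lookup A i ≡ false → i ∉ A
lookup≡false⇒∉ A-i i∈A with () ← trans (sym ([]=⇒lookup i∈A)) A-i

proposition5p3 : (m : ℕ) (S T : Subset (suc m)) → S ≤G T →
    ((Linked S T × Toric S T) ⇔ ((fromℕ m ∉ S) × (T ≡ S ∪ ⁅ fromℕ m ⁆)))
proposition5p3 m S T S≤T = mk⇔ linked-toric⇒ ⇒linked-toric
  where
  linked-toric⇒ : Linked S T × Toric S T → (fromℕ m ∉ S) × (T ≡ S ∪ ⁅ fromℕ m ⁆)
  linked-toric⇒ (linked , d , dim , ℓS+d≡ℓT) =
    let ℓS+n≡ℓT = subst (λ d → ℓ S + d ≡ ℓ T) (DimP-unique {S = S} {T = T} dim linked) ℓS+d≡ℓT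
        steps    = ℓ-gap-tight S T (linked⇒countAbove-< m {S} {T} S≤T linked) ℓS+n≡ℓT
        S-last , T≡S+L = countAbove-suc⇒insert-last m S T steps
    in lookup≡false⇒∉ S-last , trans T≡S+L (sym (∪-⁅⁆ S (fromℕ m)))

  ⇒linked-toric : (fromℕ m ∉ S) × (T ≡ S ∪ ⁅ fromℕ m ⁆) → Linked S T × Toric S T
  ⇒linked-toric (L∉S , refl) rewrite ∪-⁅⁆ S (fromℕ m) =
    let S-last = ∉⇒lookup≡false L∉S in TopExtension.linked m S S-last , TopExtension.toric m S S-last
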